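{- For all $n\ge 3$, $\overline{q}_n(123,132,213,231,312)=1$.
   Context: For a positive integer $n$, let $\mathcal{S}_{n,n}$ denote the set of all permutations (words) $\pi=\pi_1\cdots\pi_{2n}$ of the multiset $\{1,1,2,2,\ldots,n,n\}$. A word $\pi$ contains a pattern $\sigma=\sigma_1\cdots\sigma_k$ if there are indices $i_1<\cdots<i_k$ such that $\pi_{i_a}=\pi_{i_b}$ iff $\sigma_a=\sigma_b$ and $\pi_{i_a}<\pi_{i_b}$ iff $\sigma_a<\sigma_b$ for all $a,b$; otherwise $\pi$ avoids $\sigma$. The quasi-Stirling permutations $\overline{\mathcal{Q}}_n$ are the $\pi\in\mathcal{S}_{n,n}$ avoiding both $1212$ and $2121$. For a set $\Lambda$ of patterns, $\overline{\mathcal{Q}}_n(\Lambda)$ is the set of $\pi\in\overline{\mathcal{Q}}_n$ avoiding every pattern in $\Lambda$, and $\overline{q}_n(\Lambda)=|\overline{\mathcal{Q}}_n(\Lambda)|$. -}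

module Defs where

open import Data.Nat using (ℕ; zero; suc; _<_)
open import Data.Fin using (Fin; cast)
open import Data.List using (List; []; _∷_; _++_; length; lookup)
open import Data.List.Relation.Binary.Permutation.Propositional using (_↭_)
open import Data.List.Relation.Binary.Sublist.Propositional using (_⊆_)
open import Data.Product using (Σ; _×_)
open import Function.Bundles using (_⇔_)
open import Relation.Binary.PropositionalEquality using (_≡_)
open import Relation.Nullary using (¬_)

doubled : ℕ → List ℕ
doubled zero    = []
doubled (suc n) = doubled n ++ (suc n ∷ suc n ∷ [])

InS : ℕ → List ℕ → Set
InS n π = π ↭ doubled n

OrderIso : List ℕ → List ℕ → Set
OrderIso w σ =
  Σ (length w ≡ length σ) λ eq →
    (a b : Fin (length w)) →
      ((lookup w a ≡ lookup w b) ⇔ (lookup σ (cast eq a) ≡ lookup σ (cast eq b)))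
      × ((lookup w a < lookup w b) ⇔ (lookup σ (cast eq a) < lookup σ (cast eq b)))

Contains : List ℕ → List ℕ → Set
Contains π σ = Σ (List ℕ) λ w → (w ⊆ π) × OrderIso w σ

Avoids : List ℕ → List ℕ → Set
Avoids π σ = ¬ Contains π σ

QuasiStirling : ℕ → List ℕ → Set
QuasiStirling n π = InS n π × Avoids π (1 ∷ 2 ∷ 1 ∷ 2 ∷ []) × Avoids π (2 ∷ 1 ∷ 2 ∷ 1 ∷ [])

AvoidsAll : List ℕ → List (List ℕ) → Set
AvoidsAll π []       = Data.Unit.⊤ where import Data.Unit
AvoidsAll π (σ ∷ Λ) = Avoids π σ × AvoidsAll π Λ

InQbar : ℕ → List (List ℕ) → List ℕ → Set
InQbar n Λ π = QuasiStirling n π × AvoidsAll π Λ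

Λ₅ : List (List ℕ)
Λ₅ = (1 ∷ 2 ∷ 3 ∷ []) ∷ (1 ∷ 3 ∷ 2 ∷ []) ∷ (2 ∷ 1 ∷ 3 ∷ []) ∷ (2 ∷ 3 ∷ 1 ∷ []) ∷ (3 ∷ 1 ∷ 2 ∷ []) ∷ []

-- Λ₅ consists of all patterns on three distinct letters except 321. If π has at least
-- three distinct letters, an occurrence a ⋯ b with a ≠ b can be extended by a third letter
-- different from both, and the resulting triple must form 321; wherever the third letter
-- sits, this forces b < a. So π is weakly decreasing, and the only weakly decreasing
-- arrangement of {1,1,…,n,n} is nn⋯2211, which avoids every pattern with an ascent.
module Submission where

open import Defs
open import Data.Nat using (ℕ; zero; suc; _≥_; _<_; _≤_; z≤n; s≤s; z<s; s<s; _≟_)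
open import Data.Nat.Properties
  using (≤-refl; ≤-trans; ≤-totalOrder; <⇒≤; <⇒≢; <⇒≱; <-trans; <-irrefl; <-cmp; m≤n⇒m≤1+n; m≤n⇒m<n∨m≡n)
open import Data.Fin as Fin using (Fin; zero; suc; cast)
open import Data.Fin.Properties using (toℕ-cast; cast-involutive)
open import Data.List using (List; []; _∷_; length; lookup)
open import Data.List.Membership.Propositional using (_∈_)
open import Data.List.Membership.Propositional.Properties using (∈-++⁺ˡ; ∈-++⁺ʳ)
open import Data.List.Relation.Unary.Any using (here; there)
open import Data.List.Relation.Unary.All as All using (All; []; _∷_)
open import Data.List.Relation.Unary.AllPairs using (AllPairs; []; _∷_)
open import Data.List.Relation.Unary.Sorted.TotalOrder.Properties using (AllPairs⇒Sorted; lookup-mono-≤; ↗↭↗⇒≋)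
open import Data.List.Relation.Binary.Equality.Propositional using (≋⇒≡)
open import Data.List.Relation.Binary.Permutation.Propositional using (_↭_; prep; ↭-refl; ↭-sym; ↭-trans; ↭⇒↭ₛ)
open import Data.List.Relation.Binary.Permutation.Propositional.Properties using (∈-resp-↭; ++-comm)
open import Data.List.Relation.Binary.Sublist.Propositional using (_⊆_; []; _∷_; _∷ʳ_; ⊆-refl; ⊆-trans; from∈)
open import Data.List.Relation.Binary.Sublist.Propositional.Properties using (All-resp-⊆; ∷ˡ⁻)
open import Data.Product using (∃!; ∃-syntax; _×_; _,_; proj₁; proj₂)
open import Data.Sum as Sum using (_⊎_; inj₁; inj₂)
open import Data.Unit using (tt)
open import Function.Bundles using (_⇔_; mk⇔; Equivalence)
open import Function.Properties.Equivalence using () renaming (sym to ⇔-sym)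
open import Relation.Binary.Properties.TotalOrder ≤-totalOrder using (≥-totalOrder)
open import Relation.Binary.PropositionalEquality using (_≡_; _≢_; refl; sym; subst₂; ≢-sym)
open import Relation.Binary.Definitions using (tri<; tri≈; tri>)
open import Relation.Nullary using (yes; no; contradiction)

private
  variable
    A : Set
    x y z : A
    xs ys : List A

AllPairs-resp-⊆ : ∀ {R : A → A → Set} → xs ⊆ ys → AllPairs R ys → AllPairs R xs
AllPairs-resp-⊆ []         []         = []
AllPairs-resp-⊆ (_ ∷ʳ s)   (_ ∷ rys)  = AllPairs-resp-⊆ s rys
AllPairs-resp-⊆ (refl ∷ s) (ry ∷ rys) = All-resp-⊆ s ry ∷ AllPairs-resp-⊆ s rys

∈-insert-singleton : (y ∷ []) ⊆ xs → z ∈ xs → z ≢ y →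
                     (z ∷ y ∷ []) ⊆ xs ⊎ (y ∷ z ∷ []) ⊆ xs
∈-insert-singleton (_ ∷ʳ s)   (here refl) _   = inj₁ (refl ∷ s)
∈-insert-singleton (v ∷ʳ s)   (there z∈)  z≢y = Sum.map (v ∷ʳ_) (v ∷ʳ_) (∈-insert-singleton s z∈ z≢y)
∈-insert-singleton (refl ∷ _) (here refl) z≢y = contradiction refl z≢y
∈-insert-singleton (refl ∷ _) (there z∈)  _   = inj₂ (refl ∷ from∈ z∈)

∈-insert-pair : (x ∷ y ∷ []) ⊆ xs → z ∈ xs → z ≢ x → z ≢ y →
                (z ∷ x ∷ y ∷ []) ⊆ xs ⊎ (x ∷ z ∷ y ∷ []) ⊆ xs ⊎ (x ∷ y ∷ z ∷ []) ⊆ xs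
∈-insert-pair (_ ∷ʳ s)   (here refl) _   _   = inj₁ (refl ∷ s)
∈-insert-pair (v ∷ʳ s)   (there z∈)  z≢x z≢y =
  Sum.map (v ∷ʳ_) (Sum.map (v ∷ʳ_) (v ∷ʳ_)) (∈-insert-pair s z∈ z≢x z≢y)
∈-insert-pair (refl ∷ _) (here refl) z≢x _   = contradiction refl z≢x
∈-insert-pair (refl ∷ s) (there z∈)  _   z≢y =
  inj₂ (Sum.map (refl ∷_) (refl ∷_) (∈-insert-singleton s z∈ z≢y))

Descending : List ℕ → Set
Descending = AllPairs _≥_

Descending-lookup : ∀ {w} → Descending w → {i j : Fin (length w)} → i Fin.≤ j → lookup w j ≤ lookup w i
Descending-lookup w↘ = lookup-mono-≤ ≥-totalOrder (AllPairs⇒Sorted ≥-totalOrder w↘)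

Descending-↭-unique : ∀ {xs ys} → Descending xs → Descending ys → xs ↭ ys → xs ≡ ys
Descending-↭-unique xs↘ ys↘ xs↭ys =
  ≋⇒≡ (↗↭↗⇒≋ ≥-totalOrder (AllPairs⇒Sorted ≥-totalOrder xs↘) (AllPairs⇒Sorted ≥-totalOrder ys↘) (↭⇒↭ₛ xs↭ys))

Descending-avoids-ascent : ∀ {π σ} → Descending π → (i j : Fin (length σ)) → i Fin.≤ j →
                           lookup σ i < lookup σ j → Avoids π σ
Descending-avoids-ascent {σ = σ} π↘ i j i≤j σi<σj (w , w⊆π , eq , iso) =
  <⇒≱ wi<wj (Descending-lookup (AllPairs-resp-⊆ w⊆π π↘) i′≤j′)
  where
  i′ j′ : Fin (length w)
  i′ = cast (sym eq) i
  j′ = cast (sym eq) j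
  i′≤j′ : i′ Fin.≤ j′
  i′≤j′ = subst₂ _≤_ (sym (toℕ-cast (sym eq) i)) (sym (toℕ-cast (sym eq) j)) i≤j
  wi<wj : lookup w i′ < lookup w j′
  wi<wj = Equivalence.from (proj₂ (iso i′ j′))
    (subst₂ (λ a b → lookup σ a < lookup σ b)
            (sym (cast-involutive eq (sym eq) i)) (sym (cast-involutive eq (sym eq) j)) σi<σj)

SameOrder : ℕ → ℕ → ℕ → ℕ → Set
SameOrder a b p q = ((a ≡ b) ⇔ (p ≡ q)) × ((a < b) ⇔ (p < q))

SameOrder-refl : ∀ a p → SameOrder a a p p
SameOrder-refl a p = mk⇔ (λ _ → refl) (λ _ → refl)
                   , mk⇔ (λ a<a → contradiction a<a (<-irrefl refl)) (λ p<p → contradiction p<p (<-irrefl refl))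

SameOrder-swap : ∀ {a b p q} → SameOrder a b p q → SameOrder p q a b
SameOrder-swap (≡⇔ , <⇔) = ⇔-sym ≡⇔ , ⇔-sym <⇔

SameOrder-preserves-> : ∀ {a b p q} → SameOrder a b p q → b < a → q < p
SameOrder-preserves-> {p = p} {q} (≡⇔ , <⇔) b<a with <-cmp p q
... | tri< p<q _ _ = contradiction (<⇒≤ (Equivalence.from <⇔ p<q)) (<⇒≱ b<a)
... | tri≈ _ p≡q _ = contradiction (sym (Equivalence.from ≡⇔ p≡q)) (<⇒≢ b<a)
... | tri> _ _ q<p = q<p

SameOrder-flip : ∀ {a b p q} → SameOrder a b p q → SameOrder b a q p
SameOrder-flip s@(≡⇔ , _) =
  mk⇔ (λ b≡a → sym (Equivalence.to ≡⇔ (sym b≡a))) (λ q≡p → sym (Equivalence.from ≡⇔ (sym q≡p)))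
  , mk⇔ (SameOrder-preserves-> s) (SameOrder-preserves-> (SameOrder-swap s))

SameOrder-< : ∀ {a b p q} → a < b → p < q → SameOrder a b p q
SameOrder-< a<b p<q = mk⇔ (λ a≡b → contradiction a≡b (<⇒≢ a<b)) (λ p≡q → contradiction p≡q (<⇒≢ p<q))
                    , mk⇔ (λ _ → p<q) (λ _ → a<b)

SameOrder-<ᵒᵖ : ∀ {a b p q} → b < a → q < p → SameOrder a b p q
SameOrder-<ᵒᵖ b<a q<p = SameOrder-flip (SameOrder-< b<a q<p)

OrderIso-triple : ∀ {a b c p q r} → SameOrder a b p q → SameOrder a c p r → SameOrder b c q r →
                  OrderIso (a ∷ b ∷ c ∷ []) (p ∷ q ∷ r ∷ [])
OrderIso-triple {a} {b} {c} {p} {q} {r} ab ac bc = refl , pairs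
  where
  pairs : (i j : Fin 3) → _
  pairs zero             zero             = SameOrder-refl a p
  pairs zero             (suc zero)       = ab
  pairs zero             (suc (suc zero)) = ac
  pairs (suc zero)       zero             = SameOrder-flip ab
  pairs (suc zero)       (suc zero)       = SameOrder-refl b q
  pairs (suc zero)       (suc (suc zero)) = bc
  pairs (suc (suc zero)) zero             = SameOrder-flip ac
  pairs (suc (suc zero)) (suc zero)       = SameOrder-flip bc
  pairs (suc (suc zero)) (suc (suc zero)) = SameOrder-refl c r

1<2 : 1 < 2
1<2 = s<s z<s

1<3 : 1 < 3
1<3 = s<s z<s

2<3 : 2 < 3
2<3 = s<s (s<s z<s)

distinct-triple-pattern : ∀ {a b c} → a ≢ b → b ≢ c → a ≢ c →
                          (c < b × b < a) ⊎ ∃[ σ ] σ ∈ Λ₅ × OrderIso (a ∷ b ∷ c ∷ []) σ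
distinct-triple-pattern {a} {b} {c} a≢b b≢c a≢c with <-cmp a b | <-cmp b c | <-cmp a c
... | tri≈ _ a≡b _ | _            | _            = contradiction a≡b a≢b
... | _            | tri≈ _ b≡c _ | _            = contradiction b≡c b≢c
... | _            | _            | tri≈ _ a≡c _ = contradiction a≡c a≢c
... | tri> _ _ b<a | tri> _ _ c<b | _            = inj₁ (c<b , b<a)
... | tri< a<b _ _ | tri< b<c _ _ | tri< a<c _ _ = inj₂ (_ , here refl ,
      OrderIso-triple (SameOrder-< a<b 1<2) (SameOrder-< a<c 1<3) (SameOrder-< b<c 2<3))
... | tri< a<b _ _ | tri< b<c _ _ | tri> _ _ c<a = contradiction (<-trans c<a (<-trans a<b b<c)) (<-irrefl refl)
... | tri< a<b _ _ | tri> _ _ c<b | tri< a<c _ _ = inj₂ (_ , there (here refl) ,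
      OrderIso-triple (SameOrder-< a<b 1<3) (SameOrder-< a<c 1<2) (SameOrder-<ᵒᵖ c<b 2<3))
... | tri> _ _ b<a | tri< b<c _ _ | tri< a<c _ _ = inj₂ (_ , there (there (here refl)) ,
      OrderIso-triple (SameOrder-<ᵒᵖ b<a 1<2) (SameOrder-< a<c 2<3) (SameOrder-< b<c 1<3))
... | tri< a<b _ _ | tri> _ _ c<b | tri> _ _ c<a = inj₂ (_ , there (there (there (here refl))) ,
      OrderIso-triple (SameOrder-< a<b 2<3) (SameOrder-<ᵒᵖ c<a 1<2) (SameOrder-<ᵒᵖ c<b 1<3))
... | tri> _ _ b<a | tri< b<c _ _ | tri> _ _ c<a = inj₂ (_ , there (there (there (there (here refl)))) ,
      OrderIso-triple (SameOrder-<ᵒᵖ b<a 1<3) (SameOrder-<ᵒᵖ c<a 2<3) (SameOrder-< b<c 1<2))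

AvoidsAll-∈ : ∀ {π Λ σ} → AvoidsAll π Λ → σ ∈ Λ → Avoids π σ
AvoidsAll-∈ (avoids-σ , _) (here refl) = avoids-σ
AvoidsAll-∈ (_ , avoids-Λ) (there σ∈Λ) = AvoidsAll-∈ avoids-Λ σ∈Λ

module _ {π : List ℕ} (π-avoids : AvoidsAll π Λ₅) (fresh : ∀ a b → ∃[ z ] z ∈ π × z ≢ a × z ≢ b) where

  distinct-letters-decrease : ∀ {a b c} → (a ∷ b ∷ c ∷ []) ⊆ π → a ≢ b → b ≢ c → a ≢ c → c < b × b < a
  distinct-letters-decrease abc⊆π a≢b b≢c a≢c with distinct-triple-pattern a≢b b≢c a≢c
  ... | inj₁ decreasing         = decreasing
  ... | inj₂ (σ , σ∈Λ₅ , abc≅σ) = contradiction (_ , abc⊆π , abc≅σ) (AvoidsAll-∈ π-avoids σ∈Λ₅)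

  pair-decreasing : ∀ {a b} → (a ∷ b ∷ []) ⊆ π → b ≤ a
  pair-decreasing {a} {b} ab⊆π with a ≟ b
  ... | yes refl = ≤-refl
  ... | no a≢b with fresh a b
  ... | z , z∈π , z≢a , z≢b with ∈-insert-pair ab⊆π z∈π z≢a z≢b
  ... | inj₁ zab⊆π        = <⇒≤ (proj₁ (distinct-letters-decrease zab⊆π z≢a a≢b z≢b))
  ... | inj₂ (inj₁ azb⊆π) = let b<z , z<a = distinct-letters-decrease azb⊆π (≢-sym z≢a) z≢b a≢b
                            in <⇒≤ (<-trans b<z z<a)
  ... | inj₂ (inj₂ abz⊆π) = <⇒≤ (proj₂ (distinct-letters-decrease abz⊆π a≢b (≢-sym z≢b) (≢-sym z≢a)))

  sublist-descending : ∀ {xs} → xs ⊆ π → Descending xs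
  sublist-descending {[]}     _    = []
  sublist-descending {x ∷ xs} xs⊆π =
    All.tabulate (λ y∈xs → pair-decreasing (⊆-trans (refl ∷ from∈ y∈xs) xs⊆π)) ∷ sublist-descending (∷ˡ⁻ xs⊆π)

  avoiding-descending : Descending π
  avoiding-descending = sublist-descending ⊆-refl

countdown : ℕ → List ℕ
countdown zero    = []
countdown (suc n) = suc n ∷ suc n ∷ countdown n

countdown-≤ : ∀ n → All (_≤ n) (countdown n)
countdown-≤ zero    = []
countdown-≤ (suc n) = ≤-refl ∷ ≤-refl ∷ All.map m≤n⇒m≤1+n (countdown-≤ n)

countdown-descending : ∀ n → Descending (countdown n)
countdown-descending zero    = []
countdown-descending (suc n) = (≤-refl ∷ below) ∷ below ∷ countdown-descending n
  where
  below : All (_≤ suc n) (countdown n)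
  below = All.map m≤n⇒m≤1+n (countdown-≤ n)

countdown-↭-doubled : ∀ n → countdown n ↭ doubled n
countdown-↭-doubled zero    = ↭-refl
countdown-↭-doubled (suc n) =
  ↭-trans (prep (suc n) (prep (suc n) (countdown-↭-doubled n))) (++-comm (suc n ∷ suc n ∷ []) (doubled n))

countdown-InQbar : ∀ n → InQbar n Λ₅ (countdown n)
countdown-InQbar n = (countdown-↭-doubled n , ascent₀₁ 1<2 , ascent₁₂ 1<2)
                   , ascent₀₁ 1<2 , ascent₀₁ 1<3 , ascent₁₂ 1<3 , ascent₀₁ 2<3 , ascent₁₂ 1<2 , tt
  where
  ascent₀₁ : ∀ {p q σ} → p < q → Avoids (countdown n) (p ∷ q ∷ σ)
  ascent₀₁ = Descending-avoids-ascent (countdown-descending n) zero (suc zero) z≤n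
  ascent₁₂ : ∀ {p q r σ} → q < r → Avoids (countdown n) (p ∷ q ∷ r ∷ σ)
  ascent₁₂ = Descending-avoids-ascent (countdown-descending n) (suc zero) (suc (suc zero)) (s≤s z≤n)

∈-doubled : ∀ {k n} → 1 ≤ k → k ≤ n → k ∈ doubled n
∈-doubled {n = zero}  1≤k k≤0 = contradiction k≤0 (<⇒≱ 1≤k)
∈-doubled {n = suc n} 1≤k k≤1+n with m≤n⇒m<n∨m≡n k≤1+n
... | inj₁ (s<s k≤n) = ∈-++⁺ˡ (∈-doubled 1≤k k≤n)
... | inj₂ refl      = ∈-++⁺ʳ (doubled n) (here refl)

fresh-among-1-2-3 : ∀ a b → ∃[ z ] 1 ≤ z × z ≤ 3 × z ≢ a × z ≢ b
fresh-among-1-2-3 a b with 1 ≟ a | 1 ≟ b | 2 ≟ a | 2 ≟ b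
... | no 1≢a   | no 1≢b   | _        | _        = 1 , s≤s z≤n , s≤s z≤n , 1≢a , 1≢b
... | yes refl | _        | _        | no 2≢b   = 2 , s≤s z≤n , s≤s (s≤s z≤n) , (λ ()) , 2≢b
... | _        | yes refl | no 2≢a   | _        = 2 , s≤s z≤n , s≤s (s≤s z≤n) , 2≢a , (λ ())
... | yes refl | _        | _        | yes refl = 3 , s≤s z≤n , ≤-refl , (λ ()) , (λ ())
... | _        | yes refl | yes refl | _        = 3 , s≤s z≤n , ≤-refl , (λ ()) , (λ ())

doubled-fresh : ∀ {n} → n ≥ 3 → ∀ a b → ∃[ z ] z ∈ doubled n × z ≢ a × z ≢ b
doubled-fresh n≥3 a b with fresh-among-1-2-3 a b
... | z , 1≤z , z≤3 , z≢a , z≢b = z , ∈-doubled 1≤z (≤-trans z≤3 n≥3) , z≢a , z≢b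

theorem4p19 : (n : ℕ) → n ≥ 3 → ∃! _≡_ (λ (π : List ℕ) → InQbar n Λ₅ π)
theorem4p19 n n≥3 = countdown n , countdown-InQbar n , unique
  where
  unique : ∀ {π} → InQbar n Λ₅ π → countdown n ≡ π
  unique {π} ((π↭doubled , _) , π-avoids) =
    Descending-↭-unique (countdown-descending n) (avoiding-descending π-avoids fresh)
                        (↭-trans (countdown-↭-doubled n) (↭-sym π↭doubled))
    where
    fresh : ∀ a b → ∃[ z ] z ∈ π × z ≢ a × z ≢ b
    fresh a b with doubled-fresh n≥3 a b
    ... | z , z∈doubled , z≢a , z≢b = z , ∈-resp-↭ (↭-sym π↭doubled) z∈doubled , z≢a , z≢b
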